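{- Let $a,b,c$ be positive integers with $\gcd(a,b,c)=1$ and $a\mid{\rm lcm}(b,c)$. Put $l_1={\rm lcm}(a,b)$ and $l_2={\rm lcm}(a,c)$. If $\lambda$ is a complex number with $\lambda\ne 0$, $\lambda^{a}\ne1$, $\lambda^{b}\ne1$ and $\lambda^{c}\ne1$, then \begin{align*} \sum_{n\in{\rm NR}(a,b,c)}\lambda^n n&=\frac{l_1(\lambda^{l_2}-1)+l_2(\lambda^{l_1}-1)+(l_1+l_2-a-b-c)(\lambda^{l_1}-1)(\lambda^{l_2}-1)}{(\lambda^a-1)(\lambda^b-1)(\lambda^c-1)}\\ &\quad -\frac{(\lambda^{l_1}-1)(\lambda^{l_2}-1)}{(\lambda^a-1)(\lambda^b-1)(\lambda^c-1)}\left(\frac{a}{\lambda^a-1}+\frac{b}{\lambda^b-1}+\frac{c}{\lambda^c-1}\right)+\frac{\lambda}{(\lambda-1)^2}. \end{align*}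
   Context: ${\rm NR}(a,b,c)$ denotes the (finite) set of positive integers that cannot be written as $xa+yb+zc$ with nonnegative integers $x,y,z$. -}

module Defs where

open import Level using (Level)
open import Data.Nat using (ℕ; zero; suc; _≤_) renaming (_+_ to _+ℕ_; _*_ to _*ℕ_)
open import Data.List using (List; []; _∷_)
open import Data.Product using (_×_; ∃-syntax)
open import Relation.Nullary using (¬_)
open import Relation.Binary.PropositionalEquality using (_≡_)
open import Algebra.Bundles using (CommutativeRing)

Representable : ℕ → ℕ → ℕ → ℕ → Set
Representable a b c n = ∃[ x ] ∃[ y ] ∃[ z ] (x *ℕ a +ℕ y *ℕ b +ℕ z *ℕ c ≡ n)

InNR : ℕ → ℕ → ℕ → ℕ → Set
InNR a b c n = (1 ≤ n) × ¬ Representable a b c n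

module RingOps {c ℓ : Level} (R : CommutativeRing c ℓ) where
  open CommutativeRing R

  pow : Carrier → ℕ → Carrier
  pow x zero = 1#
  pow x (suc n) = x * pow x n

  ι : ℕ → Carrier
  ι zero = 0#
  ι (suc n) = 1# + ι n

  sumL : (ℕ → Carrier) → List ℕ → Carrier
  sumL f [] = 0#
  sumL f (n ∷ ns) = f n + sumL f ns

  IsCharZeroField : Set (c Level.⊔ ℓ)
  IsCharZeroField =
    (¬ (1# ≈ 0#))
    × (∀ x → ¬ (x ≈ 0#) → ∃[ y ] (x * y ≈ 1#))
    × (∀ n → ¬ (ι (suc n) ≈ 0#))

{-# OPTIONS --safe #-}
-- Let S = ⟨a, b, c⟩ and l₁ = lcm(a, b) = B b, l₂ = lcm(a, c) = C c. Since gcd(a, b, c) = 1 and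
-- a ∣ lcm(b, c), the cofactor B divides a and c and is coprime to b (symmetrically for C), so
-- every element of S is uniquely i b + j c + x a with i < B, j < C, x ≥ 0: the Apéry set of a
-- in S is {i b + j c : i < B, j < C}. Both (NR + a) ⊎ [0, a) and NR ⊎ Ap(S, a) enumerate the
-- n with n - a ∉ S. Summing over this identity a function F with F(n + a) - F(n) = λⁿ n gives
-- Σ_{n ∈ NR} λⁿ n = Σ_{Ap} F - Σ_{n < a} F, and both sums factor into geometric sums in λᵇ,
-- λᶜ and λ and their weighted versions, which telescope; the closed form then is an identity
-- of commutative rings modulo the relations defining the inverses of λᵃ - 1, λᵇ - 1, λᶜ - 1.
module Submission where

open import Defs
open import Level using (Level)
open import Data.Nat using (ℕ; _<_) renaming (_+_ to _+ℕ_)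
open import Data.Nat.Divisibility using (_∣_)
open import Data.Nat.GCD using (gcd)
open import Data.Nat.LCM using (lcm)
open import Data.List using (List)
open import Data.List.Membership.Propositional using (_∈_)
open import Data.List.Relation.Unary.Unique.Propositional using (Unique)
open import Function.Bundles using (_⇔_)
open import Relation.Nullary using (¬_)
open import Relation.Binary.PropositionalEquality using (_≡_)
open import Algebra.Bundles using (CommutativeRing)

open import Data.Nat as ℕ using (zero; suc)
import Data.Nat.Properties as ℕ
open import Data.Fin using (Fin; toℕ)
import Data.Fin as Fin
open import Data.Product using (proj₁; proj₂)
open import Data.Integer as ℤ using (ℤ; -[1+_]) renaming (+_ to +ℤ_)
import Data.Integer.Properties as ℤ
open import Data.Sign as Sign using ()
open import Data.Maybe using (Maybe; just; nothing)
open import Data.List using ([]; _∷_; _++_; map; foldr; tabulate; applyUpTo; upTo; allFin; cartesianProductWith)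
open import Data.List.Properties using (map-tabulate)
open import Data.List.Relation.Binary.Permutation.Propositional using (_↭_; ↭⇒↭ₛ′)
import Data.List.Relation.Binary.Permutation.Propositional.Properties as ↭
import Data.List.Relation.Binary.Permutation.Setoid.Properties as ↭ₛ
open import Function using (_∘_; id)
open import Relation.Nullary using (yes; no)
import Relation.Binary.PropositionalEquality as ≡
import Algebra.Solver.Ring.AlmostCommutativeRing as ACR

module NumberTheory where
  open import Data.Nat
  open import Data.Nat.Properties
  open import Data.Nat.Divisibility
  open import Data.Nat.Coprimality using (Coprime; coprime-divisor)
  open import Data.Nat.GCD using (gcd; gcd[m,n]∣m; gcd[m,n]∣n; gcd-greatest; gcd[m,n]≢0; gcd-assoc; gcd-comm)
  open import Data.Nat.LCM using (lcm; lcm-least; gcd*lcm; lcm-comm)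
  open import Data.Nat.Solver using (module +-*-Solver)
  open import Data.Product using (_×_; _,_)
  open import Data.Sum using (inj₁; inj₂)
  open import Relation.Binary.PropositionalEquality
  open import Relation.Nullary using (contradiction)
  open +-*-Solver using (solve; _:=_; _:*_; _:+_)

  record LcmCofactor (a p q : ℕ) : Set where
    field
      cofactor        : ℕ
      cofactor*p≡lcm  : cofactor * p ≡ lcm a p
      cofactor∣a      : cofactor ∣ a
      cofactor∣q      : cofactor ∣ q
      cofactor-coprime : Coprime cofactor p

  -- The cofactor is a / gcd(a, p); it divides q because a ∣ p q and it is coprime to p / gcd(a, p).
  lcmCofactor : ∀ {a p q} → 0 < a → gcd (gcd a p) q ≡ 1 → a ∣ lcm p q → LcmCofactor a p q
  lcmCofactor {a} {p} {q} 0<a gcd≡1 a∣lcm =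
    split (gcd[m,n]∣m a p) (gcd[m,n]∣n a p)
    where
    g : ℕ
    g = gcd a p
    instance
      g≢0 : NonZero g
      g≢0 = >-nonZero (n≢0⇒n>0 (gcd[m,n]≢0 a p (inj₁ (m<n⇒n≢0 0<a))))
    split : g ∣ a → g ∣ p → LcmCofactor a p q
    split (divides m a≡m*g) (divides p′ p≡p′*g) = record
      { cofactor = m
      ; cofactor*p≡lcm = m*p≡lcm
      ; cofactor∣a = m∣a
      ; cofactor∣q = m∣q
      ; cofactor-coprime = m⊥p
      }
      where
      m∣a : m ∣ a
      m∣a = divides g (trans a≡m*g (*-comm m g))
      m⊥p′ : Coprime m p′
      m⊥p′ {d} (d∣m , d∣p′) =
        ∣1⇒≡1 (*-cancelʳ-∣ g (subst (d * g ∣_) (sym (*-identityˡ g)) d*g∣g))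
        where
        d*g∣g : d * g ∣ g
        d*g∣g = gcd-greatest (subst (d * g ∣_) (sym a≡m*g) (*-monoˡ-∣ g d∣m))
                             (subst (d * g ∣_) (sym p≡p′*g) (*-monoˡ-∣ g d∣p′))
      m∣p′*q : m ∣ p′ * q
      m∣p′*q = *-cancelʳ-∣ g (subst₂ _∣_ a≡m*g p*q≡p′*q*g a∣p*q)
        where
        a∣p*q : a ∣ p * q
        a∣p*q = ∣-trans a∣lcm (lcm-least {p} {q} (m∣m*n q) (n∣m*n p))
        p*q≡p′*q*g : p * q ≡ p′ * q * g
        p*q≡p′*q*g = trans (cong (_* q) p≡p′*g)
                           (solve 3 (λ x y z → x :* z :* y := x :* y :* z) refl p′ q g)
      m∣q : m ∣ q
      m∣q = coprime-divisor m⊥p′ m∣p′*q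
      m⊥p : Coprime m p
      m⊥p {d} (d∣m , d∣p) =
        ∣1⇒≡1 (subst (d ∣_) gcd≡1
          (gcd-greatest (gcd-greatest (∣-trans d∣m m∣a) d∣p) (∣-trans d∣m m∣q)))
      m*p≡lcm : m * p ≡ lcm a p
      m*p≡lcm = *-cancelˡ-≡ (m * p) (lcm a p) g (sym (begin
        g * lcm a p ≡⟨ gcd*lcm a p ⟩
        a * p       ≡⟨ cong (_* p) a≡m*g ⟩
        m * g * p   ≡⟨ solve 3 (λ x y z → x :* y :* z := y :* (x :* z)) refl m g p ⟩
        g * (m * p) ∎))
        where open ≡-Reasoning

  lcmCofactors : ∀ {a b c} → 0 < a → gcd (gcd a b) c ≡ 1 → a ∣ lcm b c →
                 LcmCofactor a b c × LcmCofactor a c b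
  lcmCofactors {a} {b} {c} 0<a gcd≡1 a∣lcm =
    lcmCofactor 0<a gcd≡1 a∣lcm , lcmCofactor 0<a gcd′≡1 (subst (a ∣_) (lcm-comm b c) a∣lcm)
    where
    gcd′≡1 : gcd (gcd a c) b ≡ 1
    gcd′≡1 = trans (gcd-assoc a c b) (trans (cong (gcd a) (gcd-comm c b)) (trans (sym (gcd-assoc a b c)) gcd≡1))

  cofactor>0 : ∀ {a p q} → 0 < a → (F : LcmCofactor a p q) → 0 < LcmCofactor.cofactor F
  cofactor>0 0<a F =
    n≢0⇒n>0 λ m≡0 → m<n⇒n≢0 0<a (0∣⇒≡0 (subst (_∣ _) m≡0 (LcmCofactor.cofactor∣a F)))

  *-divMod : ∀ {y r q m p s} → y ≡ r + q * m → m * p ≡ s → y * p ≡ r * p + q * s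
  *-divMod {y} {r} {q} {m} {p} {s} y≡ m*p≡s = begin
    y * p               ≡⟨ cong (_* p) y≡ ⟩
    (r + q * m) * p     ≡⟨ solve 4 (λ r q m p → (r :+ q :* m) :* p := r :* p :+ q :* (m :* p)) refl r q m p ⟩
    r * p + q * (m * p) ≡⟨ cong (λ t → r * p + q * t) m*p≡s ⟩
    r * p + q * s       ∎
    where open ≡-Reasoning

  module _ {d p : ℕ} (d⊥p : Coprime d p) where

    coprime-small-multiple≡0 : ∀ {u v t} → d ∣ u → d ∣ v → t < d → u ≡ t * p + v → t ≡ 0
    coprime-small-multiple≡0 {t = zero} _ _ _ _ = refl
    coprime-small-multiple≡0 {u} {v} {suc t} d∣u d∣v t<d u≡ = contradiction (∣⇒≤ d∣t) (<⇒≱ t<d)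
      where
      d∣t : d ∣ suc t
      d∣t = coprime-divisor d⊥p (subst (d ∣_) (*-comm (suc t) p)
              (∣m+n∣m⇒∣n (subst (d ∣_) (trans u≡ (+-comm (suc t * p) v)) d∣u) d∣v))

    coprime-residue-unique-≤ : ∀ {u v y y′} → d ∣ u → d ∣ v → y′ < d → y ≤ y′ →
                               y * p + u ≡ y′ * p + v → y ≡ y′
    coprime-residue-unique-≤ {u} {v} {y} {y′} d∣u d∣v y′<d y≤y′ eq =
      trans (sym (+-identityʳ y)) (trans (cong (y +_) (sym t≡0)) (m+[n∸m]≡n y≤y′))
      where
      shifted : y * p + u ≡ y * p + ((y′ ∸ y) * p + v)
      shifted = begin
        y * p + u                   ≡⟨ eq ⟩
        y′ * p + v                  ≡⟨ cong (λ k → k * p + v) (m+[n∸m]≡n y≤y′) ⟨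
        (y + (y′ ∸ y)) * p + v      ≡⟨ cong (_+ v) (*-distribʳ-+ p y (y′ ∸ y)) ⟩
        y * p + (y′ ∸ y) * p + v    ≡⟨ +-assoc (y * p) _ v ⟩
        y * p + ((y′ ∸ y) * p + v)  ∎
        where open ≡-Reasoning
      t≡0 : y′ ∸ y ≡ 0
      t≡0 = coprime-small-multiple≡0 d∣u d∣v (≤-<-trans (m∸n≤m y′ y) y′<d) (+-cancelˡ-≡ (y * p) _ _ shifted)

    coprime-residue-unique : ∀ {u v y y′} → d ∣ u → d ∣ v → y < d → y′ < d →
                             y * p + u ≡ y′ * p + v → y ≡ y′
    coprime-residue-unique {y = y} {y′} d∣u d∣v y<d y′<d eq with ≤-total y y′
    ... | inj₁ y≤y′ = coprime-residue-unique-≤ d∣u d∣v y′<d y≤y′ eq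
    ... | inj₂ y′≤y = sym (coprime-residue-unique-≤ d∣v d∣u y<d y′≤y (sym eq))

open NumberTheory

module AperySet {a b c : ℕ} (0<a : 0 < a) (FB : LcmCofactor a b c) (FC : LcmCofactor a c b) where
  open import Data.Nat
  open import Data.Nat.Properties
  open import Data.Nat.Divisibility
  open import Data.Nat.DivMod using (_divMod_; result)
  open import Data.Nat.LCM using (lcm; m∣lcm[m,n])
  open import Data.Nat.Solver using (module +-*-Solver)
  open import Data.Fin using (Fin; toℕ)
  open import Data.Fin.Properties using (toℕ-injective; toℕ<n)
  open import Data.Product using (_×_; _,_; ∃-syntax; proj₁; proj₂)
  open import Relation.Binary.PropositionalEquality
  open import Relation.Nullary using (¬_; yes; no; contradiction)
  open import Data.Sum using (inj₁; inj₂)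
  open import Data.List using (List; map; _++_; upTo; allFin; cartesianProductWith)
  open import Data.List.Membership.Propositional using (_∈_)
  open import Data.List.Membership.Propositional.Properties
    using (∈-cartesianProductWith⁺; ∈-cartesianProductWith⁻; ∈-allFin; ∈-map⁺; ∈-map⁻;
           ∈-upTo⁺; ∈-upTo⁻; ∈-++⁺ˡ; ∈-++⁺ʳ; ∈-++⁻)
  open import Data.List.Membership.DecPropositional _≟_ using (_∈?_)
  open import Data.List.Relation.Unary.Unique.Propositional using (Unique)
  open import Data.List.Relation.Unary.Unique.Propositional.Properties
    using (cartesianProductWith⁺; allFin⁺; upTo⁺; map⁺; ++⁺)
  open import Data.List.Relation.Binary.Permutation.Propositional using (_↭_)
  open import Data.List.Relation.Binary.BagAndSetEquality using (∼bag⇒↭)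
  open import Data.List.Membership.Propositional.Properties.WithK using (unique∧set⇒bag)
  open import Function.Bundles using (_⇔_; mk⇔; Equivalence)
  open import Function.Properties.Equivalence using () renaming (trans to ⇔-trans; sym to ⇔-sym)
  open +-*-Solver using (solve; _:=_; _:*_; _:+_)

  open LcmCofactor

  B C : ℕ
  B = cofactor FB
  C = cofactor FC

  instance
    a≢0 : NonZero a
    a≢0 = >-nonZero 0<a
    B≢0 : NonZero B
    B≢0 = >-nonZero (cofactor>0 0<a FB)
    C≢0 : NonZero C
    C≢0 = >-nonZero (cofactor>0 0<a FC)

  aperyElem : Fin B → Fin C → ℕ
  aperyElem i j = toℕ i * b + toℕ j * c

  normalForm-injective : ∀ {i j x i′ j′ x′} → aperyElem i j + x * a ≡ aperyElem i′ j′ + x′ * a →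
                         i ≡ i′ × j ≡ j′ × x ≡ x′
  normalForm-injective {i} {j} {x} {i′} {j′} {x′} eq = i≡i′ , j≡j′ , *-cancelʳ-≡ x x′ a x*a≡x′*a
    where
    rest : ∀ {m q} (F : LcmCofactor a m q) z w → cofactor F ∣ z * q + w * a
    rest F z w = ∣m∣n⇒∣m+n (∣n⇒∣m*n z (cofactor∣q F)) (∣n⇒∣m*n w (cofactor∣a F))
    c-first : ∀ y z w → y * b + z * c + w * a ≡ z * c + (y * b + w * a)
    c-first y z w = solve 6 (λ y z w a b c → y :* b :+ z :* c :+ w :* a := z :* c :+ (y :* b :+ w :* a))
                            refl y z w a b c
    i≡i′ : i ≡ i′
    i≡i′ = toℕ-injective (coprime-residue-unique (cofactor-coprime FB)
             (rest FB (toℕ j) x) (rest FB (toℕ j′) x′) (toℕ<n i) (toℕ<n i′)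
             (trans (sym (+-assoc (toℕ i * b) _ _)) (trans eq (+-assoc (toℕ i′ * b) _ _))))
    j≡j′ : j ≡ j′
    j≡j′ = toℕ-injective (coprime-residue-unique (cofactor-coprime FC)
             (rest FC (toℕ i) x) (rest FC (toℕ i′) x′) (toℕ<n j) (toℕ<n j′)
             (trans (sym (c-first (toℕ i) (toℕ j) x)) (trans eq (c-first (toℕ i′) (toℕ j′) x′))))
    x*a≡x′*a : x * a ≡ x′ * a
    x*a≡x′*a = +-cancelˡ-≡ (aperyElem i j) _ _
                 (trans eq (cong (_+ x′ * a) (cong₂ aperyElem (sym i≡i′) (sym j≡j′))))

  Rep : ℕ → Set
  Rep = Representable a b c

  NormalForm : ℕ → Set
  NormalForm n = ∃[ x ] ∃[ i ] ∃[ j ] n ≡ aperyElem i j + x * a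

  normalForm : ∀ {n} → Rep n → NormalForm n
  normalForm {n} (x , y , z , x*a+y*b+z*c≡n)
    with y divMod B | z divMod C | m∣lcm[m,n] a b | m∣lcm[m,n] a c
  ... | result q i y≡ | result t j z≡ | divides k lcm[a,b]≡k*a | divides l lcm[a,c]≡l*a =
    x + q * k + t * l , i , j , (begin
      n                                                          ≡⟨ x*a+y*b+z*c≡n ⟨
      x * a + y * b + z * c                                      ≡⟨ cong₂ (λ u v → x * a + u + v) y*b≡ z*c≡ ⟩
      x * a + (toℕ i * b + q * (k * a)) + (toℕ j * c + t * (l * a))
        ≡⟨ solve 10 (λ x a i b q k j c t l → x :* a :+ (i :* b :+ q :* (k :* a)) :+ (j :* c :+ t :* (l :* a))
                                         := i :* b :+ j :* c :+ (x :+ q :* k :+ t :* l) :* a)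
                 refl x a (toℕ i) b q k (toℕ j) c t l ⟩
      toℕ i * b + toℕ j * c + (x + q * k + t * l) * a            ∎)
    where
    open ≡-Reasoning
    y*b≡ : y * b ≡ toℕ i * b + q * (k * a)
    y*b≡ = *-divMod {r = toℕ i} {q} y≡ (trans (cofactor*p≡lcm FB) lcm[a,b]≡k*a)
    z*c≡ : z * c ≡ toℕ j * c + t * (l * a)
    z*c≡ = *-divMod {r = toℕ j} {t} z≡ (trans (cofactor*p≡lcm FC) lcm[a,c]≡l*a)

  rep-0 : Rep 0
  rep-0 = 0 , 0 , 0 , refl

  rep-+a : ∀ {n} → Rep n → Rep (n + a)
  rep-+a (x , y , z , eq) = suc x , y , z ,
    trans (solve 6 (λ x a y b z c → a :+ x :* a :+ y :* b :+ z :* c := x :* a :+ y :* b :+ z :* c :+ a)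
                   refl x a y b z c)
          (cong (_+ a) eq)

  rep-normalForm : ∀ x i j → Rep (aperyElem i j + x * a)
  rep-normalForm x i j = x , toℕ i , toℕ j ,
    solve 6 (λ x a i b j c → x :* a :+ i :* b :+ j :* c := i :* b :+ j :* c :+ x :* a)
            refl x a (toℕ i) b (toℕ j) c

  +-suc-* : ∀ e x → e + suc x * a ≡ e + x * a + a
  +-suc-* e x = trans (cong (e +_) (+-comm a (x * a))) (sym (+-assoc e (x * a) a))

  -- n - a ∉ S, where n - a < 0 also counts as ∉ S.
  NotRepMinusA : ℕ → Set
  NotRepMinusA n = a ≤ n → ¬ Rep (n ∸ a)

  apery : List ℕ
  apery = cartesianProductWith aperyElem (allFin B) (allFin C)

  apery-unique : Unique apery
  apery-unique = cartesianProductWith⁺ aperyElem aperyElem-injective (allFin⁺ B) (allFin⁺ C)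
    where
    aperyElem-injective : ∀ {i i′ j j′} → aperyElem i j ≡ aperyElem i′ j′ → i ≡ i′ × j ≡ j′
    aperyElem-injective eq
      with i≡i′ , j≡j′ , _ ← normalForm-injective {x = 0} {x′ = 0} (cong (_+ 0) eq) = i≡i′ , j≡j′

  ∈apery⇔ : ∀ {n} → n ∈ apery ⇔ (Rep n × NotRepMinusA n)
  ∈apery⇔ {n} = mk⇔ to from
    where
    to : n ∈ apery → Rep n × NotRepMinusA n
    to n∈ with i , j , _ , _ , refl ← ∈-cartesianProductWith⁻ aperyElem (allFin B) (allFin C) n∈ =
      subst Rep (+-identityʳ _) (rep-normalForm 0 i j) , λ a≤n rep → not-shifted a≤n (normalForm rep)
      where
      not-shifted : a ≤ aperyElem i j → ¬ NormalForm (aperyElem i j ∸ a)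
      not-shifted a≤n (x , i′ , j′ , eq) =
        0≢1+n (proj₂ (proj₂ (normalForm-injective {i} {j} {0} {i′} {j′} {suc x} (begin
        aperyElem i j + 0                ≡⟨ +-identityʳ _ ⟩
        aperyElem i j                    ≡⟨ m∸n+n≡m a≤n ⟨
        aperyElem i j ∸ a + a            ≡⟨ cong (_+ a) eq ⟩
        aperyElem i′ j′ + x * a + a      ≡⟨ +-suc-* (aperyElem i′ j′) x ⟨
        aperyElem i′ j′ + suc x * a      ∎))))
        where open ≡-Reasoning
    from : Rep n × NotRepMinusA n → n ∈ apery
    from (rep , notRep) with normalForm rep
    ... | zero , i , j , refl =
      subst (_∈ apery) (sym (+-identityʳ _)) (∈-cartesianProductWith⁺ aperyElem (∈-allFin i) (∈-allFin j))
    ... | suc x , i , j , refl = contradiction (subst Rep (sym n∸a≡) (rep-normalForm x i j)) (notRep a≤n)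
      where
      a≤n : a ≤ aperyElem i j + suc x * a
      a≤n = ≤-trans (m≤m+n a (x * a)) (m≤n+m _ (aperyElem i j))
      n∸a≡ : aperyElem i j + suc x * a ∸ a ≡ aperyElem i j + x * a
      n∸a≡ = trans (cong (_∸ a) (+-suc-* (aperyElem i j) x)) (m+n∸n≡m _ a)

  module _ {NR : List ℕ} (NR-unique : Unique NR) (∈NR⇔ : ∀ n → (n ∈ NR) ⇔ InNR a b c n) where

    ∈NR : ∀ {n} → 1 ≤ n → ¬ Rep n → n ∈ NR
    ∈NR 1≤n ¬rep = Equivalence.from (∈NR⇔ _) (1≤n , ¬rep)

    ∉NR-rep : ∀ {n} → n ∈ NR → ¬ Rep n
    ∉NR-rep n∈NR = proj₂ (Equivalence.to (∈NR⇔ _) n∈NR)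

    ¬rep⇒positive : ∀ {n} → ¬ Rep n → 1 ≤ n
    ¬rep⇒positive {zero} ¬rep = contradiction rep-0 ¬rep
    ¬rep⇒positive {suc n} ¬rep = s≤s z≤n

    ∈shiftedNR⇔ : ∀ {n} → n ∈ map (_+ a) NR ++ upTo a ⇔ NotRepMinusA n
    ∈shiftedNR⇔ {n} = mk⇔ to from
      where
      to : n ∈ map (_+ a) NR ++ upTo a → NotRepMinusA n
      to n∈ a≤n with ∈-++⁻ (map (_+ a) NR) n∈
      ... | inj₁ n∈map with m , m∈NR , refl ← ∈-map⁻ (_+ a) n∈map =
        subst (λ k → ¬ Rep k) (sym (m+n∸n≡m m a)) (∉NR-rep m∈NR)
      ... | inj₂ n∈upTo = contradiction a≤n (<⇒≱ (∈-upTo⁻ n∈upTo))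
      from : NotRepMinusA n → n ∈ map (_+ a) NR ++ upTo a
      from notRep with n <? a
      ... | yes n<a = ∈-++⁺ʳ _ (∈-upTo⁺ n<a)
      ... | no n≮a =
        ∈-++⁺ˡ (subst (_∈ map (_+ a) NR) (m∸n+n≡m a≤n) (∈-map⁺ (_+ a) (∈NR (¬rep⇒positive ¬rep) ¬rep)))
        where
        a≤n : a ≤ n
        a≤n = ≮⇒≥ n≮a
        ¬rep : ¬ Rep (n ∸ a)
        ¬rep = notRep a≤n

    ∈NR++apery⇔ : ∀ {n} → n ∈ NR ++ apery ⇔ NotRepMinusA n
    ∈NR++apery⇔ {n} = mk⇔ to from
      where
      to : n ∈ NR ++ apery → NotRepMinusA n
      to n∈ with ∈-++⁻ NR n∈
      ... | inj₁ n∈NR = λ a≤n rep → ∉NR-rep n∈NR (subst Rep (m∸n+n≡m a≤n) (rep-+a rep))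
      ... | inj₂ n∈apery = proj₂ (Equivalence.to ∈apery⇔ n∈apery)
      from : NotRepMinusA n → n ∈ NR ++ apery
      from notRep with n ∈? NR | n ∈? apery
      ... | yes n∈NR | _ = ∈-++⁺ˡ n∈NR
      ... | no _ | yes n∈apery = ∈-++⁺ʳ NR n∈apery
      ... | no n∉NR | no n∉apery = contradiction (∈NR (¬rep⇒positive ¬rep) ¬rep) n∉NR
        where
        ¬rep : ¬ Rep n
        ¬rep rep = n∉apery (Equivalence.from ∈apery⇔ (rep , notRep))

    shiftedNR↭NR++apery : map (_+ a) NR ++ upTo a ↭ NR ++ apery
    shiftedNR↭NR++apery = ∼bag⇒↭ (unique∧set⇒bag shifted-unique (++⁺ NR-unique apery-unique NR-apery-disjoint)
                                     (⇔-trans ∈shiftedNR⇔ (⇔-sym ∈NR++apery⇔)))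
      where
      map-upTo-disjoint : ∀ {n} → ¬ (n ∈ map (_+ a) NR × n ∈ upTo a)
      map-upTo-disjoint (n∈map , n∈upTo) with m , _ , refl ← ∈-map⁻ (_+ a) n∈map =
        <⇒≱ (∈-upTo⁻ n∈upTo) (m≤n+m a m)
      shifted-unique : Unique (map (_+ a) NR ++ upTo a)
      shifted-unique = ++⁺ (map⁺ (λ {m} {n} → +-cancelʳ-≡ a m n) NR-unique) (upTo⁺ a) map-upTo-disjoint
      NR-apery-disjoint : ∀ {n} → ¬ (n ∈ NR × n ∈ apery)
      NR-apery-disjoint (n∈NR , n∈apery) = ∉NR-rep n∈NR (proj₁ (Equivalence.to ∈apery⇔ n∈apery))


module RingArithmetic {c ℓ : Level} (R : CommutativeRing c ℓ) where
  open CommutativeRing R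
  open RingOps R
  open import Algebra.Properties.Ring ring
    using (-‿distribˡ-*; -‿distribʳ-*; -‿involutive; -0#≈0#; -‿+-comm)
  open import Relation.Binary.Reasoning.Setoid setoid
  open import Algebra.Properties.AbelianGroup +-abelianGroup using (⁻¹-anti-homo-∙; xyx⁻¹≈y)

  ι-+ : ∀ m n → ι (m ℕ.+ n) ≈ ι m + ι n
  ι-+ zero n = sym (+-identityˡ _)
  ι-+ (suc m) n = trans (+-congˡ (ι-+ m n)) (sym (+-assoc _ _ _))

  ι-* : ∀ m n → ι (m ℕ.* n) ≈ ι m * ι n
  ι-* zero n = sym (zeroˡ _)
  ι-* (suc m) n = begin
    ι (n ℕ.+ m ℕ.* n)     ≈⟨ ι-+ n (m ℕ.* n) ⟩
    ι n + ι (m ℕ.* n)     ≈⟨ +-cong (*-identityˡ _) (sym (ι-* m n)) ⟨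
    1# * ι n + ι m * ι n  ≈⟨ distribʳ _ _ _ ⟨
    (1# + ι m) * ι n      ∎

  ι-suc-suc : ∀ m n → ι (suc (suc (m ℕ.+ n))) ≈ ι (suc m) + ι (suc n)
  ι-suc-suc m n = ≡.subst (λ k → ι k ≈ ι (suc m) + ι (suc n)) (ℕ.+-suc (suc m) n) (ι-+ (suc m) (suc n))

  ι-suc-∸ : ∀ m n → ι (suc m) - ι (suc n) ≈ ι m - ι n
  ι-suc-∸ m n = begin
    (1# + ι m) - (1# + ι n)       ≈⟨ +-congˡ (⁻¹-anti-homo-∙ 1# (ι n)) ⟩
    (1# + ι m) + (- ι n + - 1#)   ≈⟨ +-assoc _ _ _ ⟨
    (1# + ι m) + - ι n + - 1#     ≈⟨ +-congʳ (+-assoc _ _ _) ⟩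
    1# + (ι m - ι n) - 1#         ≈⟨ xyx⁻¹≈y 1# _ ⟩
    ι m - ι n                     ∎

  ιℤ : ℤ → Carrier
  ιℤ (+ℤ n) = ι n
  ιℤ -[1+ n ] = - ι (suc n)

  ιℤ-⊖ : ∀ m n → ιℤ (m ℤ.⊖ n) ≈ ι m - ι n
  ιℤ-⊖ zero zero = sym (-‿inverseʳ 0#)
  ιℤ-⊖ zero (suc n) = sym (+-identityˡ _)
  ιℤ-⊖ (suc m) zero = sym (trans (+-congˡ -0#≈0#) (+-identityʳ _))
  ιℤ-⊖ (suc m) (suc n) = begin
    ιℤ (suc m ℤ.⊖ suc n)  ≡⟨ ≡.cong ιℤ (ℤ.[1+m]⊖[1+n]≡m⊖n m n) ⟩
    ιℤ (m ℤ.⊖ n)          ≈⟨ ιℤ-⊖ m n ⟩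
    ι m - ι n             ≈⟨ ι-suc-∸ m n ⟨
    ι (suc m) - ι (suc n) ∎

  ιℤ-+ : ∀ i j → ιℤ (i ℤ.+ j) ≈ ιℤ i + ιℤ j
  ιℤ-+ (+ℤ m) (+ℤ n) = ι-+ m n
  ιℤ-+ (+ℤ m) -[1+ n ] = ιℤ-⊖ m (suc n)
  ιℤ-+ -[1+ m ] (+ℤ n) = trans (ιℤ-⊖ n (suc m)) (+-comm _ _)
  ιℤ-+ -[1+ m ] -[1+ n ] = trans (-‿cong (ι-suc-suc m n)) (sym (-‿+-comm _ _))

  ιℤ-neg : ∀ i → ιℤ (ℤ.- i) ≈ - ιℤ i
  ιℤ-neg (+ℤ zero) = sym -0#≈0#
  ιℤ-neg (+ℤ suc n) = refl
  ιℤ-neg -[1+ n ] = sym (-‿involutive _)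

  ιℤ-* : ∀ i j → ιℤ (i ℤ.* j) ≈ ιℤ i * ιℤ j
  ιℤ-* (+ℤ m) (+ℤ n) =
    trans (≡.subst (λ k → ιℤ k ≈ ι (m ℕ.* n)) (≡.sym (ℤ.+◃n≡+n (m ℕ.* n))) refl) (ι-* m n)
  ιℤ-* (+ℤ zero) -[1+ n ] = sym (zeroˡ _)
  ιℤ-* (+ℤ suc m) -[1+ n ] = trans (-‿cong (ι-* (suc m) (suc n))) (-‿distribʳ-* _ _)
  ιℤ-* -[1+ m ] (+ℤ zero) =
    trans (≡.subst (λ k → ιℤ (Sign.- ℤ.◃ k) ≈ 0#) (≡.sym (ℕ.*-zeroʳ m)) refl) (sym (zeroʳ _))
  ιℤ-* -[1+ m ] (+ℤ suc n) = trans (-‿cong (ι-* (suc m) (suc n))) (-‿distribˡ-* _ _)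
  ιℤ-* -[1+ m ] -[1+ n ] = begin
    ι (suc m ℕ.* suc n)             ≈⟨ ι-* (suc m) (suc n) ⟩
    ι (suc m) * ι (suc n)           ≈⟨ -‿involutive _ ⟨
    - - (ι (suc m) * ι (suc n))     ≈⟨ -‿cong (-‿distribʳ-* _ _) ⟩
    - (ι (suc m) * - ι (suc n))     ≈⟨ -‿distribˡ-* _ _ ⟩
    - ι (suc m) * - ι (suc n)       ∎

  -- ι up to ≈, but sending 1 to 1# on the nose, so that the constant 1 of
  -- the solver's expressions is literally 1#.
  ι₁ : ℕ → Carrier
  ι₁ zero = 0#
  ι₁ (suc zero) = 1#
  ι₁ (suc (suc n)) = 1# + ι₁ (suc n)

  ι₁≈ι : ∀ n → ι₁ n ≈ ι n
  ι₁≈ι zero = refl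
  ι₁≈ι (suc zero) = sym (+-identityʳ 1#)
  ι₁≈ι (suc (suc n)) = +-congˡ (ι₁≈ι (suc n))

  ιℤ₁ : ℤ → Carrier
  ιℤ₁ (+ℤ n) = ι₁ n
  ιℤ₁ -[1+ n ] = - ι₁ (suc n)

  ιℤ₁≈ιℤ : ∀ i → ιℤ₁ i ≈ ιℤ i
  ιℤ₁≈ιℤ (+ℤ n) = ι₁≈ι n
  ιℤ₁≈ιℤ -[1+ n ] = -‿cong (ι₁≈ι (suc n))

  ιℤ₁-morphism : ℤ.+-*-rawRing ACR.-Raw-AlmostCommutative⟶ ACR.fromCommutativeRing R
  ιℤ₁-morphism = record
    { ⟦_⟧ = ιℤ₁
    ; +-homo = λ i j → trans (ιℤ₁≈ιℤ (i ℤ.+ j))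
                         (trans (ιℤ-+ i j) (sym (+-cong (ιℤ₁≈ιℤ i) (ιℤ₁≈ιℤ j))))
    ; *-homo = λ i j → trans (ιℤ₁≈ιℤ (i ℤ.* j))
                         (trans (ιℤ-* i j) (sym (*-cong (ιℤ₁≈ιℤ i) (ιℤ₁≈ιℤ j))))
    ; -‿homo = λ i → trans (ιℤ₁≈ιℤ (ℤ.- i)) (trans (ιℤ-neg i) (sym (-‿cong (ιℤ₁≈ιℤ i))))
    ; 0-homo = refl
    ; 1-homo = refl
    }

  ιℤ₁-≟ : ∀ i j → Maybe (ιℤ₁ i ≈ ιℤ₁ j)
  ιℤ₁-≟ i j with i ℤ.≟ j
  ... | yes ≡.refl = just refl
  ... | no _ = nothing

  open import Algebra.Solver.Ring ℤ.+-*-rawRing (ACR.fromCommutativeRing R) ιℤ₁-morphism ιℤ₁-≟ public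

  -- An identity that holds only modulo relations u ≈ v is proved by letting the
  -- solver check lhs = rhs + Σ cᵢ (uᵢ - vᵢ) and then dropping the multiples.
  x+y*[u-v]≈x : ∀ {u v} y z → u ≈ v → y + z * (u - v) ≈ y
  x+y*[u-v]≈x y z u≈v =
    trans (+-congˡ (trans (*-congˡ (trans (+-congʳ u≈v) (-‿inverseʳ _))) (zeroʳ z))) (+-identityʳ y)

module FiniteSums {c ℓ : Level} (R : CommutativeRing c ℓ) where
  open CommutativeRing R
  open RingOps R
  open RingArithmetic R using (solve; _:=_; _:+_; _:-_)
  open import Relation.Binary.Reasoning.Setoid setoid
  open import Algebra.Properties.Semiring.Sum semiring public
    using (sum-syntax; ∑-distrib-+; *-distribˡ-sum; *-distribʳ-sum; sum-cong-≋)

  sumL-as-foldr : ∀ f ns → sumL f ns ≡ foldr _+_ 0# (map f ns)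
  sumL-as-foldr f [] = ≡.refl
  sumL-as-foldr f (n ∷ ns) = ≡.cong (f n +_) (sumL-as-foldr f ns)

  sumL-↭ : ∀ f {ms ns} → ms ↭ ns → sumL f ms ≈ sumL f ns
  sumL-↭ f {ms} {ns} ms↭ns = begin
    sumL f ms                 ≡⟨ sumL-as-foldr f ms ⟩
    foldr _+_ 0# (map f ms)   ≈⟨ ↭ₛ.foldr-commMonoid setoid +-isCommutativeMonoid
                                   (↭⇒↭ₛ′ isEquivalence (↭.map⁺ f ms↭ns)) ⟩
    foldr _+_ 0# (map f ns)   ≡⟨ sumL-as-foldr f ns ⟨
    sumL f ns                 ∎


  sumL-cong : ∀ {f g} → (∀ n → f n ≈ g n) → ∀ ns → sumL f ns ≈ sumL g ns
  sumL-cong f≈g [] = refl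
  sumL-cong f≈g (n ∷ ns) = +-cong (f≈g n) (sumL-cong f≈g ns)

  sumL-++ : ∀ f ms ns → sumL f (ms ++ ns) ≈ sumL f ms + sumL f ns
  sumL-++ f [] ns = sym (+-identityˡ _)
  sumL-++ f (m ∷ ms) ns = trans (+-congˡ (sumL-++ f ms ns)) (sym (+-assoc _ _ _))

  sumL-map : ∀ f g ns → sumL f (map g ns) ≡ sumL (f ∘ g) ns
  sumL-map f g [] = ≡.refl
  sumL-map f g (n ∷ ns) = ≡.cong (f (g n) +_) (sumL-map f g ns)

  sumL-- : ∀ f g ns → sumL (λ n → f n - g n) ns ≈ sumL f ns - sumL g ns
  sumL-- f g [] = sym (-‿inverseʳ 0#)
  sumL-- f g (n ∷ ns) = trans (+-congˡ (sumL-- f g ns))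
    (solve 4 (λ x y u v → (x :- y) :+ (u :- v) := (x :+ u) :- (y :+ v)) refl (f n) (g n) (sumL f ns) (sumL g ns))

  sumL-tabulate : ∀ f {n} (g : Fin n → ℕ) → sumL f (tabulate g) ≡ ∑[ i < n ] f (g i)
  sumL-tabulate f {zero} g = ≡.refl
  sumL-tabulate f {suc n} g = ≡.cong (f (g Fin.zero) +_) (sumL-tabulate f (g ∘ Fin.suc))

  sumL-applyUpTo : ∀ f (g : ℕ → ℕ) n → sumL f (applyUpTo g n) ≡ ∑[ i < n ] f (g (toℕ i))
  sumL-applyUpTo f g zero = ≡.refl
  sumL-applyUpTo f g (suc n) = ≡.cong (f (g 0) +_) (sumL-applyUpTo f (g ∘ suc) n)

  sumL-cartesianProductWith : ∀ {A B : Set} f (g : A → B → ℕ) {m} (h : Fin m → A) bs →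
    sumL f (cartesianProductWith g (tabulate h) bs) ≈ ∑[ i < m ] sumL f (map (g (h i)) bs)
  sumL-cartesianProductWith f g {zero} h bs = refl
  sumL-cartesianProductWith f g {suc m} h bs =
    trans (sumL-++ f (map (g (h _)) bs) _) (+-congˡ (sumL-cartesianProductWith f g (h ∘ Fin.suc) bs))

  ∑-telescope : ∀ n (g : ℕ → Carrier) → ∑[ i < n ] (g (suc (toℕ i)) - g (toℕ i)) ≈ g n - g 0
  ∑-telescope zero g = sym (-‿inverseʳ _)
  ∑-telescope (suc n) g = trans (+-congˡ (∑-telescope n (g ∘ suc)))
    (solve 3 (λ x y z → (y :- x) :+ (z :- y) := z :- x) refl (g 0) (g 1) (g (suc n)))

  sumL-cartesianProductWith-allFin : ∀ f m n (g : Fin m → Fin n → ℕ) →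
    sumL f (cartesianProductWith g (allFin m) (allFin n)) ≈ ∑[ i < m ] ∑[ j < n ] f (g i j)
  sumL-cartesianProductWith-allFin f m n g = trans (sumL-cartesianProductWith f g id (allFin n))
    (sum-cong-≋ {m} λ i →
      reflexive (≡.trans (≡.cong (sumL f) (map-tabulate id (g i))) (sumL-tabulate f (g i))))

  ∑-linearˡ : ∀ n u v (f g : Fin n → Carrier) →
              ∑[ j < n ] (u * f j + v * g j) ≈ u * ∑[ j < n ] f j + v * ∑[ j < n ] g j
  ∑-linearˡ n u v f g = trans (∑-distrib-+ {n} _ _) (sym (+-cong (*-distribˡ-sum u f) (*-distribˡ-sum v g)))

  ∑-linearʳ : ∀ n (f g : Fin n → Carrier) u v →
              ∑[ j < n ] (f j * u + g j * v) ≈ ∑[ j < n ] f j * u + ∑[ j < n ] g j * v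
  ∑-linearʳ n f g u v = trans (∑-distrib-+ {n} _ _) (sym (+-cong (*-distribʳ-sum u f) (*-distribʳ-sum v g)))

  sumL-shifted-differences : ∀ (G : ℕ → Carrier) a ns ms → map (ℕ._+ a) ns ++ upTo a ↭ ns ++ ms →
    sumL (λ n → G (n ℕ.+ a) - G n) ns ≈ sumL G ms - ∑[ j < a ] G (toℕ j)
  sumL-shifted-differences G a ns ms shifted↭ = begin
    sumL (λ n → G (n ℕ.+ a) - G n) ns  ≈⟨ sumL-- (λ n → G (n ℕ.+ a)) G ns ⟩
    Xs - Ns                            ≈⟨ solve 3 (λ X D N → X :- N := (X :+ D) :- (N :+ D)) refl Xs Ds Ns ⟩
    (Xs + Ds) - (Ns + Ds)              ≈⟨ +-congʳ lists-agree ⟩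
    (Ns + Ms) - (Ns + Ds)              ≈⟨ solve 3 (λ N M D → (N :+ M) :- (N :+ D) := M :- D) refl Ns Ms Ds ⟩
    Ms - Ds                            ∎
    where
    Xs Ns Ms Ds : Carrier
    Xs = sumL (λ n → G (n ℕ.+ a)) ns
    Ns = sumL G ns
    Ms = sumL G ms
    Ds = ∑[ j < a ] G (toℕ j)
    lists-agree : Xs + Ds ≈ Ns + Ms
    lists-agree = begin
      Xs + Ds                               ≡⟨ ≡.cong₂ _+_ (sumL-map G (ℕ._+ a) ns) (sumL-applyUpTo G id a) ⟨
      sumL G (map (ℕ._+ a) ns) + sumL G (upTo a)  ≈⟨ sumL-++ G (map (ℕ._+ a) ns) (upTo a) ⟨
      sumL G (map (ℕ._+ a) ns ++ upTo a)      ≈⟨ sumL-↭ G shifted↭ ⟩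
      sumL G (ns ++ ms)                     ≈⟨ sumL-++ G ns ms ⟩
      Ns + Ms                               ∎


module PowerSums {c ℓ : Level} (R : CommutativeRing c ℓ) (x : CommutativeRing.Carrier R) where
  open CommutativeRing R
  open RingOps R
  open RingArithmetic R using (solve; _:=_; _:+_; _:-_; _:*_; :-_; con; ι-+; x+y*[u-v]≈x)
  open FiniteSums R
  open import Relation.Binary.Reasoning.Setoid setoid

  pow-+ : ∀ m n → pow x (m ℕ.+ n) ≈ pow x m * pow x n
  pow-+ zero n = sym (*-identityˡ _)
  pow-+ (suc m) n = trans (*-congˡ (pow-+ m n)) (sym (*-assoc _ _ _))

  antidiffShift : ℕ → Carrier → Carrier
  antidiffShift k i = ι k * pow x k * (i * i)

  antidiff : ℕ → Carrier → ℕ → Carrier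
  antidiff k i n = pow x n * (ι n * i - antidiffShift k i)

  antidiff-+ : ∀ k i m n → antidiff k i (m ℕ.+ n) ≈ antidiff k i m * pow x n + i * pow x m * (pow x n * ι n)
  antidiff-+ k i m n = begin
    antidiff k i (m ℕ.+ n)
      ≈⟨ *-cong (pow-+ m n) (+-congʳ (*-congʳ (ι-+ m n))) ⟩
    pow x m * pow x n * ((ι m + ι n) * i - antidiffShift k i)
      ≈⟨ solve 6 (λ p q u v i K → p :* q :* ((u :+ v) :* i :- K) := p :* (u :* i :- K) :* q :+ i :* p :* (q :* v))
               refl (pow x m) (pow x n) (ι m) (ι n) i (antidiffShift k i) ⟩
    antidiff k i m * pow x n + i * pow x m * (pow x n * ι n) ∎

  antidiff-split : ∀ k i n → antidiff k i n ≈ pow x n * ι n * i + pow x n * (- antidiffShift k i)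
  antidiff-split k i n = solve 4 (λ p u i K → p :* (u :* i :- K) := p :* u :* i :+ p :* (:- K))
                                 refl (pow x n) (ι n) i (antidiffShift k i)

  module _ {k : ℕ} {i : Carrier} (i-inv : i * (pow x k - 1#) ≈ 1#) where

    antidiff-step : ∀ n → antidiff k i (n ℕ.+ k) - antidiff k i n ≈ pow x n * ι n
    antidiff-step n = begin
      antidiff k i (n ℕ.+ k) - antidiff k i n
        ≈⟨ +-congʳ (antidiff-+ k i n k) ⟩
      antidiff k i n * pow x k + i * pow x n * (pow x k * ι k) - antidiff k i n
        ≈⟨ solve 5 (λ p u q A i → let F = p :* (u :* i :- A :* q :* (i :* i)) in
                                  F :* q :+ i :* p :* (q :* A) :- F
                               := p :* u :+ (p :* u :- p :* A :* q :* i) :* (i :* (q :- con (+ℤ 1)) :- con (+ℤ 1)))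
                 refl (pow x n) (ι n) (pow x k) (ι k) i ⟩
      pow x n * ι n + (pow x n * ι n - pow x n * ι k * pow x k * i) * (i * (pow x k - 1#) - 1#)
        ≈⟨ x+y*[u-v]≈x _ _ i-inv ⟩
      pow x n * ι n ∎

    ∑-multiples : ∀ {f h : ℕ → Carrier} → (∀ n → h (n ℕ.+ k) - h n ≈ f n) →
                  ∀ m → ∑[ j < m ] f (toℕ j ℕ.* k) ≈ h (m ℕ.* k) - h 0
    ∑-multiples {f} {h} step m = begin
      ∑[ j < m ] f (toℕ j ℕ.* k)                             ≈⟨ sum-cong-≋ {m} (λ j → sym (step′ (toℕ j))) ⟩
      ∑[ j < m ] (h (suc (toℕ j) ℕ.* k) - h (toℕ j ℕ.* k))  ≈⟨ ∑-telescope m (λ j → h (j ℕ.* k)) ⟩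
      h (m ℕ.* k) - h 0                                      ∎
      where
      step′ : ∀ j → h (suc j ℕ.* k) - h (j ℕ.* k) ≈ f (j ℕ.* k)
      step′ j = ≡.subst (λ t → h t - h (j ℕ.* k) ≈ f (j ℕ.* k)) (ℕ.+-comm (j ℕ.* k) k) (step (j ℕ.* k))

    ∑-geometric : ∀ m {l} → m ℕ.* k ≡ l → ∑[ j < m ] pow x (toℕ j ℕ.* k) ≈ (pow x l - 1#) * i
    ∑-geometric m ≡.refl = trans (∑-multiples step m)
      (solve 2 (λ P i → P :* i :- con (+ℤ 1) :* i := (P :- con (+ℤ 1)) :* i) refl (pow x (m ℕ.* k)) i)
      where
      step : ∀ n → pow x (n ℕ.+ k) * i - pow x n * i ≈ pow x n
      step n = begin
        pow x (n ℕ.+ k) * i - pow x n * i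
          ≈⟨ +-congʳ (*-congʳ (pow-+ n k)) ⟩
        pow x n * pow x k * i - pow x n * i
          ≈⟨ solve 3 (λ p q i → p :* q :* i :- p :* i := p :+ p :* (i :* (q :- con (+ℤ 1)) :- con (+ℤ 1)))
                   refl (pow x n) (pow x k) i ⟩
        pow x n + pow x n * (i * (pow x k - 1#) - 1#)
          ≈⟨ x+y*[u-v]≈x _ _ i-inv ⟩
        pow x n ∎

    ∑-weighted-geometric : ∀ m {l} → m ℕ.* k ≡ l →
      ∑[ j < m ] (pow x (toℕ j ℕ.* k) * ι (toℕ j ℕ.* k)) ≈ antidiff k i l - antidiff k i 0
    ∑-weighted-geometric m ≡.refl = ∑-multiples antidiff-step m

  module _ {i : Carrier} (i-inv : i * (x - 1#) ≈ 1#) where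

    unit-step : ∀ (f : ℕ → Carrier) m → ∑[ j < m ] f (toℕ j) ≈ ∑[ j < m ] f (toℕ j ℕ.* 1)
    unit-step f m = sum-cong-≋ {m} (λ j → reflexive (≡.cong f (≡.sym (ℕ.*-identityʳ (toℕ j)))))

    i-inv₁ : i * (pow x 1 - 1#) ≈ 1#
    i-inv₁ = trans (*-congˡ (+-congʳ (*-identityʳ x))) i-inv

    ∑-geometric₁ : ∀ m → ∑[ j < m ] pow x (toℕ j) ≈ (pow x m - 1#) * i
    ∑-geometric₁ m = trans (unit-step (pow x) m) (∑-geometric i-inv₁ m (ℕ.*-identityʳ m))

    ∑-weighted-geometric₁ : ∀ m → ∑[ j < m ] (pow x (toℕ j) * ι (toℕ j)) ≈ antidiff 1 i m - antidiff 1 i 0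
    ∑-weighted-geometric₁ m =
      trans (unit-step (λ n → pow x n * ι n) m) (∑-weighted-geometric i-inv₁ m (ℕ.*-identityʳ m))

  ∑-antidiff : ∀ k i m (g : Fin m → ℕ) →
    ∑[ j < m ] antidiff k i (g j)
      ≈ ∑[ j < m ] (pow x (g j) * ι (g j)) * i + ∑[ j < m ] pow x (g j) * (- antidiffShift k i)
  ∑-antidiff k i m g = trans (sum-cong-≋ {m} (λ j → antidiff-split k i (g j))) (∑-linearʳ m _ _ _ _)

  ∑-antidiff-initial : ∀ k i {i₁} → i₁ * (x - 1#) ≈ 1# → ∀ m →
    ∑[ j < m ] antidiff k i (toℕ j)
      ≈ (antidiff 1 i₁ m - antidiff 1 i₁ 0) * i + (pow x m - 1#) * i₁ * (- antidiffShift k i)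
  ∑-antidiff-initial k i i₁-inv m = trans (∑-antidiff k i m toℕ)
    (+-cong (*-congʳ (∑-weighted-geometric₁ i₁-inv m)) (*-congʳ (∑-geometric₁ i₁-inv m)))

  ∑∑-antidiff-+ : ∀ k i m n (f : Fin m → ℕ) (g : Fin n → ℕ) →
    ∑[ r < m ] ∑[ s < n ] antidiff k i (f r ℕ.+ g s)
      ≈ ∑[ r < m ] antidiff k i (f r) * ∑[ s < n ] pow x (g s)
        + i * ∑[ r < m ] pow x (f r) * ∑[ s < n ] (pow x (g s) * ι (g s))
  ∑∑-antidiff-+ k i m n f g = begin
    ∑[ r < m ] ∑[ s < n ] antidiff k i (f r ℕ.+ g s)
      ≈⟨ sum-cong-≋ {m} (λ r → trans (sum-cong-≋ {n} (λ s → antidiff-+ k i (f r) (g s)))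
                                     (∑-linearˡ n _ _ _ _)) ⟩
    ∑[ r < m ] (antidiff k i (f r) * P + i * pow x (f r) * W)
      ≈⟨ ∑-linearʳ m _ _ P W ⟩
    ∑[ r < m ] antidiff k i (f r) * P + ∑[ r < m ] (i * pow x (f r)) * W
      ≈⟨ +-congˡ (*-congʳ (*-distribˡ-sum {m} i _)) ⟨
    ∑[ r < m ] antidiff k i (f r) * P + i * ∑[ r < m ] pow x (f r) * W ∎
    where
    P W : Carrier
    P = ∑[ s < n ] pow x (g s)
    W = ∑[ s < n ] (pow x (g s) * ι (g s))

  closing-identity : ∀ (a b c l₁ l₂ : ℕ) {ia ib ic i₁ : Carrier} →
    ia * (pow x a - 1#) ≈ 1# → ib * (pow x b - 1#) ≈ 1# → ic * (pow x c - 1#) ≈ 1# →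
    let K = antidiffShift a ia
        E₁ = pow x l₁ - 1#
        E₂ = pow x l₂ - 1#
        invD = ia * ib * ic
    in ((antidiff b ib l₁ - antidiff b ib 0) * ia + E₁ * ib * (- K)) * (E₂ * ic)
         + ia * (E₁ * ib) * (antidiff c ic l₂ - antidiff c ic 0)
         - ((antidiff 1 i₁ a - antidiff 1 i₁ 0) * ia + (pow x a - 1#) * i₁ * (- K))
       ≈ (ι l₁ * E₂ + ι l₂ * E₁ + (ι (l₁ ℕ.+ l₂) - ι (a ℕ.+ b ℕ.+ c)) * E₁ * E₂) * invD
         - E₁ * E₂ * invD * (ι a * ia + ι b * ib + ι c * ic)
         + x * (i₁ * i₁)
  closing-identity a b c l₁ l₂ {ia} {ib} {ic} {i₁} ia-inv ib-inv ic-inv =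
    trans (solve 17 (λ x Pa Pb Pc P₁ P₂ ia ib ic i₁ A B C L₁ L₂ L₁₂ S →
      let o = con (+ℤ 1)
          z = con (+ℤ 0)
          F P L K Pk i = P :* (L :* i :- K :* Pk :* (i :* i))
          K = A :* Pa :* (ia :* ia)
          E₁ = P₁ :- o
          E₂ = P₂ :- o
          invD = ia :* ib :* ic
          Fb = F P₁ L₁ B Pb ib :- F o z B Pb ib
          Fc = F P₂ L₂ C Pc ic :- F o z C Pc ic
          F₁ = F Pa A (o :+ z) (x :* o) i₁ :- F o z (o :+ z) (x :* o) i₁
          RHS = (L₁ :* E₂ :+ L₂ :* E₁ :+ (L₁₂ :- S) :* E₁ :* E₂) :* invD
                :- E₁ :* E₂ :* invD :* (A :* ia :+ B :* ib :+ C :* ic)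
                :+ x :* (i₁ :* i₁)
      in (Fb :* ia :+ E₁ :* ib :* (:- K)) :* (E₂ :* ic) :+ ia :* (E₁ :* ib) :* Fc
           :- (F₁ :* ia :+ (Pa :- o) :* i₁ :* (:- K))
         := RHS :+ (A :* Pa :* ia :* i₁ :+ x :* (i₁ :* i₁) :- invD :* E₁ :* E₂ :* A) :* (ia :* (Pa :- o) :- o)
                :+ (:- (invD :* E₁ :* E₂ :* B)) :* (ib :* (Pb :- o) :- o)
                :+ (:- (invD :* E₁ :* E₂ :* C)) :* (ic :* (Pc :- o) :- o)
                :+ (:- (E₁ :* E₂ :* invD)) :* (L₁₂ :- (L₁ :+ L₂))
                :+ (E₁ :* E₂ :* invD) :* (S :- (A :+ B :+ C)))
      refl x (pow x a) (pow x b) (pow x c) (pow x l₁) (pow x l₂) ia ib ic i₁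
           (ι a) (ι b) (ι c) (ι l₁) (ι l₂) (ι (l₁ ℕ.+ l₂)) (ι (a ℕ.+ b ℕ.+ c)))
    (trans (x+y*[u-v]≈x _ _ (trans (ι-+ (a ℕ.+ b) c) (+-congʳ (ι-+ a b))))
    (trans (x+y*[u-v]≈x _ _ (ι-+ l₁ l₂))
    (trans (x+y*[u-v]≈x _ _ ic-inv)
    (trans (x+y*[u-v]≈x _ _ ib-inv)
           (x+y*[u-v]≈x _ _ ia-inv)))))

module AperySums {c ℓ : Level} (R : CommutativeRing c ℓ) (x : CommutativeRing.Carrier R)
                 {a b c′ : ℕ} (0<a : 0 < a) (FB : LcmCofactor a b c′) (FC : LcmCofactor a c′ b) where
  open CommutativeRing R
  open RingOps R
  open FiniteSums R
  open PowerSums R x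
  open AperySet 0<a FB FC
  open LcmCofactor
  open import Relation.Binary.Reasoning.Setoid setoid

  apery-sum : ∀ {ia ib ic} → ib * (pow x b - 1#) ≈ 1# → ic * (pow x c′ - 1#) ≈ 1# →
    sumL (antidiff a ia) apery
      ≈ ((antidiff b ib (lcm a b) - antidiff b ib 0) * ia + (pow x (lcm a b) - 1#) * ib * (- antidiffShift a ia))
          * ((pow x (lcm a c′) - 1#) * ic)
        + ia * ((pow x (lcm a b) - 1#) * ib) * (antidiff c′ ic (lcm a c′) - antidiff c′ ic 0)
  apery-sum {ia} {ib} {ic} ib-inv ic-inv = begin
    sumL (antidiff a ia) apery
      ≈⟨ sumL-cartesianProductWith-allFin (antidiff a ia) B C aperyElem ⟩
    ∑[ i < B ] ∑[ j < C ] antidiff a ia (bᵢ i +ℕ cⱼ j)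
      ≈⟨ ∑∑-antidiff-+ a ia B C bᵢ cⱼ ⟩
    ∑[ i < B ] antidiff a ia (bᵢ i) * ∑[ j < C ] pow x (cⱼ j)
      + ia * ∑[ i < B ] pow x (bᵢ i) * ∑[ j < C ] (pow x (cⱼ j) * ι (cⱼ j))
      ≈⟨ +-cong (*-cong (trans (∑-antidiff a ia B bᵢ) (+-cong (*-congʳ weighted-b) (*-congʳ geometric-b)))
                        geometric-c)
                (*-cong (*-congˡ geometric-b) weighted-c) ⟩
    ((antidiff b ib (lcm a b) - antidiff b ib 0) * ia + (pow x (lcm a b) - 1#) * ib * (- antidiffShift a ia))
      * ((pow x (lcm a c′) - 1#) * ic)
      + ia * ((pow x (lcm a b) - 1#) * ib) * (antidiff c′ ic (lcm a c′) - antidiff c′ ic 0) ∎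
    where
    bᵢ : Fin B → ℕ
    bᵢ i = toℕ i ℕ.* b
    cⱼ : Fin C → ℕ
    cⱼ j = toℕ j ℕ.* c′
    geometric-b : ∑[ i < B ] pow x (bᵢ i) ≈ (pow x (lcm a b) - 1#) * ib
    geometric-b = ∑-geometric ib-inv B (cofactor*p≡lcm FB)
    weighted-b : ∑[ i < B ] (pow x (bᵢ i) * ι (bᵢ i)) ≈ antidiff b ib (lcm a b) - antidiff b ib 0
    weighted-b = ∑-weighted-geometric ib-inv B (cofactor*p≡lcm FB)
    geometric-c : ∑[ j < C ] pow x (cⱼ j) ≈ (pow x (lcm a c′) - 1#) * ic
    geometric-c = ∑-geometric ic-inv C (cofactor*p≡lcm FC)
    weighted-c : ∑[ j < C ] (pow x (cⱼ j) * ι (cⱼ j)) ≈ antidiff c′ ic (lcm a c′) - antidiff c′ ic 0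
    weighted-c = ∑-weighted-geometric ic-inv C (cofactor*p≡lcm FC)

theorem6 : ∀ {c ℓ : Level} (R : CommutativeRing c ℓ) →
  let open CommutativeRing R
      open RingOps R
  in IsCharZeroField →
     (a b c' : ℕ) → 0 < a → 0 < b → 0 < c' →
     gcd (gcd a b) c' ≡ 1 → a ∣ lcm b c' →
     (NR : List ℕ) → Unique NR → (∀ n → (n ∈ NR) ⇔ InNR a b c' n) →
     (lam : Carrier) → ¬ (lam ≈ 0#) →
     ¬ (pow lam a ≈ 1#) → ¬ (pow lam b ≈ 1#) → ¬ (pow lam c' ≈ 1#) →
     (ia ib ic i1 : Carrier) →
     ia * (pow lam a - 1#) ≈ 1# → ib * (pow lam b - 1#) ≈ 1# →
     ic * (pow lam c' - 1#) ≈ 1# → i1 * (lam - 1#) ≈ 1# →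
     let l₁ = lcm a b
         l₂ = lcm a c'
         E₁ = pow lam l₁ - 1#
         E₂ = pow lam l₂ - 1#
         invD = ia * ib * ic
     in sumL (λ n → pow lam n * ι n) NR
        ≈ (ι l₁ * E₂ + ι l₂ * E₁ + (ι (l₁ +ℕ l₂) - ι (a +ℕ b +ℕ c')) * E₁ * E₂) * invD
          - E₁ * E₂ * invD * (ι a * ia + ι b * ib + ι c' * ic)
          + lam * (i1 * i1)
-- The hypotheses on λ and the field axioms only guarantee that the inverses
-- ia, ib, ic, i₁ exist.
theorem6 R _ a b c′ 0<a _ _ gcd≡1 a∣lcm NR NR-unique ∈NR⇔ lam _ _ _ _ ia ib ic i₁ ia-inv ib-inv ic-inv i₁-inv =
  begin
    sumL (λ n → pow lam n * ι n) NR
      ≈⟨ sumL-cong (λ n → sym (antidiff-step ia-inv n)) NR ⟩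
    sumL (λ n → antidiff a ia (n +ℕ a) - antidiff a ia n) NR
      ≈⟨ sumL-shifted-differences (antidiff a ia) a NR apery (shiftedNR↭NR++apery NR-unique ∈NR⇔) ⟩
    sumL (antidiff a ia) apery - ∑[ j < a ] antidiff a ia (toℕ j)
      ≈⟨ +-cong (apery-sum ib-inv ic-inv) (-‿cong (∑-antidiff-initial a ia i₁-inv a)) ⟩
    _ ≈⟨ closing-identity a b c′ (lcm a b) (lcm a c′) ia-inv ib-inv ic-inv ⟩
    _ ∎
  where
  open CommutativeRing R
  open RingOps R
  open FiniteSums R
  open PowerSums R lam
  FB : LcmCofactor a b c′
  FB = proj₁ (lcmCofactors 0<a gcd≡1 a∣lcm)
  FC : LcmCofactor a c′ b
  FC = proj₂ (lcmCofactors 0<a gcd≡1 a∣lcm)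
  open AperySet 0<a FB FC
  open AperySums R lam 0<a FB FC
  open import Relation.Binary.Reasoning.Setoid setoid
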